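{- Let $\Sigma$ be a finite alphabet and let $u,v\in\Sigma^*$ be words of equal length. Then $u$ and $v$ are cyclically equalizable if and only if $\Psi(u)=\Psi(v)$, i.e. $|u|_a=|v|_a$ for every letter $a\in\Sigma$.
   Context: For a word $w\in\Sigma^*$ and $a\in\Sigma$, $|w|_a$ is the number of occurrences of $a$ in $w$, and the Parikh vector of $w$ is $\Psi(w)=(|w|_a)_{a\in\Sigma}$. For $w=a_0a_1\cdots a_{n-1}$ with $n\ge 1$ and $r\in\mathbb{Z}_n$, the cyclic shift of $w$ by $r$ is $w^{(r)}=a_ra_{r+1}\cdots a_{n-1}a_0\cdots a_{r-1}$ (indices modulo $n$); two words $x,y$ of equal length are cyclically equivalent (conjugate) if $y=x^{(r)}$ for some integer $r$ (the empty word is cyclically equivalent to itself). Given words $w_1,\dots,w_k\in\Sigma^n$ with $w_i=a_{i,0}a_{i,1}\cdots a_{i,n-1}$, a simultaneous insertion transforms each $w_i$ into $x_0a_{i,0}x_1a_{i,1}\cdots x_{n-1}a_{i,n-1}x_n$, where $x_0,\dots,x_n\in\Sigma^*$ are words that are the same for all $i$. Words $w_1,\dots,w_k$ ($k\ge2$) of equal length are cyclically equalizable if there exist words $w_1',\dots,w_k'$ obtained from $w_1,\dots,w_k$ respectively by one simultaneous insertion such that $w_1',\dots,w_k'$ are pairwise cyclically equivalent. -}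

module Defs where

open import Data.Nat using (ℕ; zero; suc)
open import Data.Fin as Fin using (Fin)
open import Data.List using (List; []; _∷_; _++_; length; [_])
open import Data.Vec using (Vec; _∷ʳ_) renaming (_∷_ to _∷v_; [] to []v)
open import Data.Product using (∃; ∃-syntax; _×_)
open import Relation.Binary.PropositionalEquality using (_≡_)
open import Relation.Nullary using (Dec; yes; no)
open import Data.Fin using (_≟_)

Word : ℕ → Set
Word m = List (Fin m)

count : ∀ {m} → Fin m → Word m → ℕ
count a [] = 0
count a (b ∷ w) with a ≟ b
... | yes _ = suc (count a w)
... | no  _ = count a w

Ψ : ∀ {m} → Word m → (Fin m → ℕ)
Ψ w a = count a w

shift1 : ∀ {m} → Word m → Word m
shift1 [] = []
shift1 (a ∷ w) = w ++ [ a ]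

-- w^{(r)} for r ∈ ℕ: r-fold one-step shift (indices mod n; every integer
-- shift modulo n is obtained for some natural r).
shift : ∀ {m} → ℕ → Word m → Word m
shift zero w = w
shift (suc r) w = shift r (shift1 w)

CycEq : ∀ {m} → Word m → Word m → Set
CycEq x y = length x ≡ length y × ∃[ r ] (y ≡ shift r x)

insert : ∀ {m n} → Vec (Word m) (suc n) → Vec (Fin m) n → Word m
insert (x ∷v []v) []v = x
insert (x ∷v xs) (a ∷v w) = x ++ (a ∷ insert xs w)

CycEqualizable : ∀ {m n k} → (Fin k → Vec (Fin m) n) → Set
CycEqualizable {m} {n} ws =
  ∃[ xs ] (∀ i j → CycEq (insert {m} {n} xs (ws i)) (insert xs (ws j)))

pair : ∀ {A : Set} → A → A → Fin 2 → A
pair u v Fin.zero = u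
pair u v (Fin.suc Fin.zero) = v

-- Inserting the same words into u and v and then rotating does not change letter counts, so
-- cyclically equalizable words have the same Parikh vector.
--
-- Conversely, call the positions j of u and v holes. It suffices to find a word W and a rotation
-- by r such that W and its rotation agree except at increasing positions, one per hole, where W
-- shows u_j and the rotation shows v_j: cutting W at these positions yields the insertion. On an
-- orbit of the rotation W is constant between consecutive holes, so the holes of an orbit must form
-- a closed trail u_j → v_j = u_j′ → v_j′ = … . Equal Parikh vectors let us build such trails by
-- induction: a hole with u_0 = v_0 gets an orbit to itself, and otherwise hole 0 is spliced into
-- the trail right after a hole p with v_p = u_0, after first replacing v_p by v_0 to keep the
-- Parikh vectors equal. Each orbit is laid out as a helix whose columns the rotation traverses one
-- after another while W lists it row by row; putting hole j in row j keeps the holes of W in order,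
-- and doubling the number of columns makes room for each splice.
module Submission where

open import Defs
open import Data.Fin as F using (Fin; toℕ)
import Data.Fin.Properties as F
open import Data.List using (List; []; _∷_; _++_; [_]; length)
open import Data.List.Properties using (++-assoc; ++-identityʳ; length-++)
open import Data.Nat using (ℕ; zero; suc; _+_; _*_; _∸_; _≤_; _<_; z≤n; s≤s; z<s; _≟_; _≤?_; _<?_; NonZero; >-nonZero; >-nonZero⁻¹; _/_; _%_)
open import Data.Nat.DivMod
open import Data.Nat.Divisibility using (n∣m*n)
open import Data.Nat.Properties
open import Algebra.Properties.CommutativeSemigroup +-commutativeSemigroup using (x∙yz≈y∙xz)
open import Data.Product using (_×_; _,_; proj₁; proj₂; ∃-syntax)
open import Data.Sum using (_⊎_; inj₁; inj₂)
open import Data.Vec as V using (Vec; []; _∷_; lookup; toList; _[_]≔_)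
open import Data.Vec.Properties using (lookup∘update; lookup∘update′)
open import Function using (_∘_)
open import Relation.Binary using (tri<; tri≈; tri>)
open import Relation.Binary.PropositionalEquality hiding ([_])
open import Relation.Nullary using (Dec; yes; no; ¬_; contradiction; _×-dec_)

ParikhEqual : ∀ {m} → Word m → Word m → Set
ParikhEqual x y = ∀ a → Ψ x a ≡ Ψ y a

count-∷ : ∀ {m} (a b : Fin m) (w : Word m) → count a (b ∷ w) ≡ count a [ b ] + count a w
count-∷ a b w with a F.≟ b
... | yes _ = refl
... | no _ = refl

count-++ : ∀ {m} (a : Fin m) (x y : Word m) → count a (x ++ y) ≡ count a x + count a y
count-++ a [] y = refl
count-++ a (b ∷ x) y = begin
  count a (b ∷ x ++ y)                    ≡⟨ count-∷ a b (x ++ y) ⟩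
  count a [ b ] + count a (x ++ y)        ≡⟨ cong (count a [ b ] +_) (count-++ a x y) ⟩
  count a [ b ] + (count a x + count a y) ≡⟨ +-assoc (count a [ b ]) _ _ ⟨
  (count a [ b ] + count a x) + count a y ≡⟨ cong (_+ count a y) (count-∷ a b x) ⟨
  count a (b ∷ x) + count a y             ∎
  where open ≡-Reasoning

count-shift1 : ∀ {m} (a : Fin m) (w : Word m) → count a (shift1 w) ≡ count a w
count-shift1 a [] = refl
count-shift1 a (b ∷ w) = begin
  count a (w ++ [ b ])          ≡⟨ count-++ a w [ b ] ⟩
  count a w + count a [ b ]     ≡⟨ +-comm (count a w) _ ⟩
  count a [ b ] + count a w     ≡⟨ count-∷ a b w ⟨
  count a (b ∷ w)               ∎
  where open ≡-Reasoning

count-shift : ∀ {m} (a : Fin m) r (w : Word m) → count a (shift r w) ≡ count a w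
count-shift a zero w = refl
count-shift a (suc r) w = trans (count-shift a r (shift1 w)) (count-shift1 a w)

count-insert : ∀ {m n} (a : Fin m) (xs : Vec (Word m) (suc n)) (w : Vec (Fin m) n) →
  count a (insert xs w) ≡ V.sum (V.map (count a) xs) + count a (toList w)
count-insert a (x ∷ []) [] = sym (trans (+-identityʳ _) (+-identityʳ _))
count-insert a (x ∷ xs@(_ ∷ _)) (b ∷ w) = begin
  count a (x ++ b ∷ insert xs w)                           ≡⟨ count-++ a x _ ⟩
  count a x + count a (b ∷ insert xs w)                    ≡⟨ cong (count a x +_) (count-∷ a b _) ⟩
  count a x + (count a [ b ] + count a (insert xs w))      ≡⟨ cong (λ t → count a x + (count a [ b ] + t)) (count-insert a xs w) ⟩
  count a x + (count a [ b ] + (Σxs + count a (toList w))) ≡⟨ cong (count a x +_) (x∙yz≈y∙xz (count a [ b ]) Σxs _) ⟩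
  count a x + (Σxs + (count a [ b ] + count a (toList w))) ≡⟨ +-assoc (count a x) Σxs _ ⟨
  (count a x + Σxs) + (count a [ b ] + count a (toList w)) ≡⟨ cong (count a x + Σxs +_) (count-∷ a b (toList w)) ⟨
  (count a x + Σxs) + count a (b ∷ toList w)               ∎
  where
  open ≡-Reasoning
  Σxs : ℕ
  Σxs = V.sum (V.map (count a) xs)

count-∷-mismatch : ∀ {m} {a b : Fin m} (x y : Word m) → a ≢ b →
  count a (a ∷ x) ≡ count a (b ∷ y) → count a y ≡ suc (count a x)
count-∷-mismatch {a = a} {b} x y a≢b eq with a F.≟ a | a F.≟ b
... | yes _ | no _ = sym eq
... | no a≢a | _ = contradiction refl a≢a
... | _ | yes a≡b = contradiction a≡b a≢b

count-∷-cong : ∀ {m} (a b : Fin m) {x y : Word m} → count a x ≡ count a y → count a (b ∷ x) ≡ count a (b ∷ y)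
count-∷-cong a b eq with a F.≟ b
... | yes _ = cong suc eq
... | no _ = eq

count-∷-cancel : ∀ {m} (a b : Fin m) (x y : Word m) → count a (b ∷ x) ≡ count a (b ∷ y) → count a x ≡ count a y
count-∷-cancel a b x y eq = +-cancelˡ-≡ (count a [ b ]) _ _ (trans (sym (count-∷ a b x)) (trans eq (count-∷ a b y)))

count-swap : ∀ {m} (a b c : Fin m) (w : Word m) → count a (b ∷ c ∷ w) ≡ count a (c ∷ b ∷ w)
count-swap a b c w = begin
  count a (b ∷ c ∷ w)                         ≡⟨ count-∷ a b _ ⟩
  count a [ b ] + count a (c ∷ w)             ≡⟨ cong (count a [ b ] +_) (count-∷ a c w) ⟩
  count a [ b ] + (count a [ c ] + count a w) ≡⟨ x∙yz≈y∙xz (count a [ b ]) (count a [ c ]) (count a w) ⟩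
  count a [ c ] + (count a [ b ] + count a w) ≡⟨ cong (count a [ c ] +_) (count-∷ a b w) ⟨
  count a [ c ] + count a (b ∷ w)             ≡⟨ count-∷ a c _ ⟨
  count a (c ∷ b ∷ w)                         ∎
  where open ≡-Reasoning

count-update : ∀ {m n} (v : Vec (Fin m) n) p {a b} → lookup v p ≡ a →
  ∀ c → count c (a ∷ toList (v [ p ]≔ b)) ≡ count c (b ∷ toList v)
count-update (_ ∷ v) F.zero refl c = count-swap c _ _ (toList v)
count-update (x ∷ v) (F.suc p) {a} {b} vₚ≡a c = begin
  count c (a ∷ x ∷ toList (v [ p ]≔ b)) ≡⟨ count-swap c a x _ ⟩
  count c (x ∷ a ∷ toList (v [ p ]≔ b)) ≡⟨ count-∷-cong c x (count-update v p vₚ≡a c) ⟩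
  count c (x ∷ b ∷ toList v)            ≡⟨ count-swap c x b _ ⟩
  count c (b ∷ x ∷ toList v)            ∎
  where open ≡-Reasoning

occurrence : ∀ {m n k} (a : Fin m) (v : Vec (Fin m) n) → count a (toList v) ≡ suc k → ∃[ p ] lookup v p ≡ a
occurrence a (b ∷ v) occurs with a F.≟ b
... | yes a≡b = F.zero , sym a≡b
... | no _ = let p , vₚ≡a = occurrence a v occurs in F.suc p , vₚ≡a

equalizable⇒ParikhEqual : ∀ {m n} (u v : Vec (Fin m) n) →
  CycEqualizable (pair u v) → ParikhEqual (toList u) (toList v)
equalizable⇒ParikhEqual u v (xs , equal) a with equal F.zero (F.suc F.zero)
... | _ , r , v′≡shift-u′ = +-cancelˡ-≡ (V.sum (V.map (count a) xs)) _ _ (begin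
  _ + count a (toList u)          ≡⟨ count-insert a xs u ⟨
  count a (insert xs u)           ≡⟨ count-shift a r _ ⟨
  count a (shift r (insert xs u)) ≡⟨ cong (count a) v′≡shift-u′ ⟨
  count a (insert xs v)           ≡⟨ count-insert a xs v ⟩
  _ + count a (toList v)          ∎)
  where open ≡-Reasoning

shift-[] : ∀ {m} r → shift {m} r [] ≡ []
shift-[] zero = refl
shift-[] (suc r) = shift-[] r

shift-+ : ∀ {m} r s (w : Word m) → shift (r + s) w ≡ shift s (shift r w)
shift-+ zero s w = refl
shift-+ (suc r) s w = shift-+ r s (shift1 w)

shift-++ : ∀ {m} (x y : Word m) → shift (length x) (x ++ y) ≡ y ++ x
shift-++ [] y = sym (++-identityʳ y)
shift-++ (a ∷ x) y = begin
  shift (length x) ((x ++ y) ++ [ a ]) ≡⟨ cong (shift (length x)) (++-assoc x y [ a ]) ⟩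
  shift (length x) (x ++ y ++ [ a ])   ≡⟨ shift-++ x (y ++ [ a ]) ⟩
  (y ++ [ a ]) ++ x                    ≡⟨ ++-assoc y [ a ] x ⟩
  y ++ a ∷ x                           ∎
  where open ≡-Reasoning

shift-length : ∀ {m} (w : Word m) → shift (length w) w ≡ w
shift-length w = trans (cong (shift (length w)) (sym (++-identityʳ w))) (shift-++ w [])

shift-*-length : ∀ {m} k (w : Word m) → shift (k * length w) w ≡ w
shift-*-length zero w = refl
shift-*-length (suc k) w = begin
  shift (length w + k * length w) w         ≡⟨ shift-+ (length w) (k * length w) w ⟩
  shift (k * length w) (shift (length w) w) ≡⟨ cong (shift (k * length w)) (shift-length w) ⟩
  shift (k * length w) w                    ≡⟨ shift-*-length k w ⟩
  w                                         ∎
  where open ≡-Reasoning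

length-shift : ∀ {m} r (w : Word m) → length (shift r w) ≡ length w
length-shift zero w = refl
length-shift (suc r) [] = length-shift r []
length-shift (suc r) (a ∷ w) = begin
  length (shift r (w ++ [ a ])) ≡⟨ length-shift r (w ++ [ a ]) ⟩
  length (w ++ [ a ])           ≡⟨ length-++ w ⟩
  length w + 1                  ≡⟨ +-comm (length w) 1 ⟩
  suc (length w)                ∎
  where open ≡-Reasoning

CycEq-refl : ∀ {m} (w : Word m) → CycEq w w
CycEq-refl w = refl , 0 , refl

CycEq-shift : ∀ {m} r (w : Word m) → CycEq w (shift r w)
CycEq-shift r w = sym (length-shift r w) , r , refl

shift-inverse : ∀ {m} r (w : Word m) → w ≡ shift (r * (length w ∸ 1)) (shift r w)
shift-inverse r [] = sym (trans (cong (shift (r * 0)) (shift-[] r)) (shift-[] (r * 0)))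
shift-inverse r w@(_ ∷ w′) = begin
  w                                 ≡⟨ shift-*-length r w ⟨
  shift (r * length w) w            ≡⟨ cong (λ t → shift t w) (*-suc r (length w′)) ⟩
  shift (r + r * length w′) w       ≡⟨ shift-+ r (r * length w′) w ⟩
  shift (r * length w′) (shift r w) ∎
  where open ≡-Reasoning

CycEq-sym : ∀ {m} {x y : Word m} → CycEq x y → CycEq y x
CycEq-sym {x = x} (_ , r , refl) = length-shift r x , r * (length x ∸ 1) , shift-inverse r x

equalizable-pair : ∀ {m n} (xs : Vec (Word m) (suc n)) (u v : Vec (Fin m) n) →
  CycEq (insert xs u) (insert xs v) → CycEqualizable (pair u v)
equalizable-pair xs u v u′∼v′ = xs , conjugate
  where
  conjugate : ∀ i j → CycEq (insert xs (pair u v i)) (insert xs (pair u v j))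
  conjugate F.zero F.zero = CycEq-refl _
  conjugate F.zero (F.suc F.zero) = u′∼v′
  conjugate (F.suc F.zero) F.zero = CycEq-sym u′∼v′
  conjugate (F.suc F.zero) (F.suc F.zero) = CycEq-refl _

slice : ∀ {A : Set} → (ℕ → A) → ℕ → ℕ → List A
slice f s zero = []
slice f s (suc l) = f s ∷ slice f (suc s) l

slice-∷ʳ : ∀ {A : Set} (f : ℕ → A) s l → slice f s (suc l) ≡ slice f s l ++ [ f (s + l) ]
slice-∷ʳ f s zero = cong (λ t → [ f t ]) (sym (+-identityʳ s))
slice-∷ʳ f s (suc l) = cong (f s ∷_) (begin
  slice f (suc s) (suc l)                   ≡⟨ slice-∷ʳ f (suc s) l ⟩
  slice f (suc s) l ++ [ f (suc s + l) ]    ≡⟨ cong (λ t → slice f (suc s) l ++ [ f t ]) (+-suc s l) ⟨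
  slice f (suc s) l ++ [ f (s + suc l) ]    ∎)
  where open ≡-Reasoning

slice-+ : ∀ {A : Set} (f : ℕ → A) r s l → slice (λ k → f (k + r)) s l ≡ slice f (s + r) l
slice-+ f r s zero = refl
slice-+ f r s (suc l) = cong (f (s + r) ∷_) (slice-+ f r (suc s) l)

shift-slice : ∀ {m} (f : ℕ → Fin m) {l} → 0 < l → (∀ k → f (k + l) ≡ f k) →
  ∀ r s → shift r (slice f s l) ≡ slice f (s + r) l
shift-slice f {suc l} _ periodic zero s = cong (λ t → slice f t (suc l)) (sym (+-identityʳ s))
shift-slice f {suc l} 0<l periodic (suc r) s = begin
  shift r (slice f (suc s) l ++ [ f s ])           ≡⟨ cong (λ x → shift r (slice f (suc s) l ++ [ x ])) (periodic s) ⟨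
  shift r (slice f (suc s) l ++ [ f (s + suc l) ]) ≡⟨ cong (λ t → shift r (slice f (suc s) l ++ [ f t ])) (+-suc s l) ⟩
  shift r (slice f (suc s) l ++ [ f (suc s + l) ]) ≡⟨ cong (shift r) (slice-∷ʳ f (suc s) l) ⟨
  shift r (slice f (suc s) (suc l))                ≡⟨ shift-slice f 0<l periodic r (suc s) ⟩
  slice f (suc s + r) (suc l)                      ≡⟨ cong (λ t → slice f t (suc l)) (+-suc s r) ⟨
  slice f (s + suc r) (suc l)                      ∎
  where open ≡-Reasoning

insert-prepend : ∀ {m n} (c : Fin m) (x : Word m) (xs : Vec (Word m) n) (w : Vec (Fin m) n) →
  insert ((c ∷ x) ∷ xs) w ≡ c ∷ insert (x ∷ xs) w
insert-prepend c x [] [] = refl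
insert-prepend c x (_ ∷ _) (_ ∷ _) = refl

module _ {m} (f f′ : ℕ → Fin m) where

  insertion-from-slices : ∀ {n} (u v : Vec (Fin m) n) (hole : Fin n → ℕ) s l →
    (∀ {i j} → i F.< j → hole i < hole j) →
    (∀ i → s ≤ hole i × hole i < s + l) →
    (∀ i → f (hole i) ≡ lookup u i) → (∀ i → f′ (hole i) ≡ lookup v i) →
    (∀ k → s ≤ k → k < s + l → f k ≡ f′ k ⊎ ∃[ i ] hole i ≡ k) →
    ∃[ xs ] insert xs u ≡ slice f s l × insert xs v ≡ slice f′ s l

  insertion-from-slices-skip : ∀ {n} (u v : Vec (Fin m) n) (hole : Fin n → ℕ) s l →
    (∀ i → s < hole i) →
    (∀ {i j} → i F.< j → hole i < hole j) →
    (∀ i → hole i < s + suc l) →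
    (∀ i → f (hole i) ≡ lookup u i) → (∀ i → f′ (hole i) ≡ lookup v i) →
    (∀ k → s ≤ k → k < s + suc l → f k ≡ f′ k ⊎ ∃[ i ] hole i ≡ k) →
    ∃[ xs ] insert xs u ≡ slice f s (suc l) × insert xs v ≡ slice f′ s (suc l)
  insertion-from-slices-skip u v hole s l s<hole increasing hole<end at-u at-v off
    with insertion-from-slices u v hole (suc s) l increasing
           (λ i → s<hole i , subst (hole i <_) (+-suc s l) (hole<end i)) at-u at-v
           (λ k s<k k<end → off k (<⇒≤ s<k) (subst (k <_) (sym (+-suc s l)) k<end))
  ... | x ∷ xs , u′≡ , v′≡ = (f s ∷ x) ∷ xs
      , trans (insert-prepend (f s) x xs u) (cong (f s ∷_) u′≡)
      , trans (insert-prepend (f s) x xs v) (cong₂ _∷_ agree v′≡)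
    where
    agree : f s ≡ f′ s
    agree with off s ≤-refl (m<m+n s z<s)
    ... | inj₁ agree = agree
    ... | inj₂ (i , hole≡s) = contradiction hole≡s (>⇒≢ (s<hole i))

  insertion-from-slices [] [] hole s zero _ _ _ _ _ = [] ∷ [] , refl , refl
  insertion-from-slices (_ ∷ _) (_ ∷ _) hole s zero _ range _ _ _ =
    contradiction (+-identityʳ s) (>⇒≢ (≤-<-trans (proj₁ (range F.zero)) (proj₂ (range F.zero))))
  insertion-from-slices [] [] hole s (suc l) increasing range =
    insertion-from-slices-skip [] [] hole s l (λ ()) increasing (proj₂ ∘ range)
  insertion-from-slices (a ∷ u) (b ∷ v) hole s (suc l) increasing range at-u at-v off
    with m≤n⇒m<n∨m≡n (proj₁ (range F.zero))
  ... | inj₁ s<first =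
    insertion-from-slices-skip (a ∷ u) (b ∷ v) hole s l s<hole increasing (proj₂ ∘ range) at-u at-v off
    where
    s<hole : ∀ i → s < hole i
    s<hole F.zero = s<first
    s<hole (F.suc i) = <-trans s<first (increasing (s≤s z≤n))
  ... | inj₂ s≡first
    with insertion-from-slices u v (hole ∘ F.suc) (suc s) l (λ i<j → increasing (s≤s i<j))
           (λ i → subst (_< hole (F.suc i)) (sym s≡first) (increasing (s≤s z≤n))
                , subst (hole (F.suc i) <_) (+-suc s l) (proj₂ (range (F.suc i))))
           (at-u ∘ F.suc) (at-v ∘ F.suc) off′
    where
    off′ : ∀ k → suc s ≤ k → k < suc s + l → f k ≡ f′ k ⊎ ∃[ i ] hole (F.suc i) ≡ k
    off′ k s<k k<end with off k (<⇒≤ s<k) (subst (k <_) (sym (+-suc s l)) k<end)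
    ... | inj₁ agree = inj₁ agree
    ... | inj₂ (F.zero , first≡k) = contradiction (trans s≡first first≡k) (<⇒≢ s<k)
    ... | inj₂ (F.suc i , hole≡k) = inj₂ (i , hole≡k)
  ... | xs@(_ ∷ _) , u′≡ , v′≡ = [] ∷ xs
      , cong₂ _∷_ (trans (sym (at-u F.zero)) (cong f (sym s≡first))) u′≡
      , cong₂ _∷_ (trans (sym (at-v F.zero)) (cong f′ (sym s≡first))) v′≡

[m+kn]%n≡m : ∀ {m n} k .{{_ : NonZero n}} → m < n → (m + k * n) % n ≡ m
[m+kn]%n≡m {m} {n} k m<n = trans ([m+kn]%n≡m%n m k n) (m<n⇒m%n≡m m<n)

[m+kn]/n≡m/n+k : ∀ m k n .{{_ : NonZero n}} → (m + k * n) / n ≡ m / n + k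
[m+kn]/n≡m/n+k m k n = trans (+-distrib-/-∣ʳ m (n∣m*n k)) (cong (m / n +_) (m*n/n≡m k n))

[m+kn]/n≡k : ∀ {m n} k .{{_ : NonZero n}} → m < n → (m + k * n) / n ≡ k
[m+kn]/n≡k {m} {n} k m<n = trans ([m+kn]/n≡m/n+k m k n) (cong (_+ k) (m<n⇒m/n≡0 m<n))

+*-mono-< : ∀ {a b d} a′ {b′} → a < d → b < b′ → a + b * d < a′ + b′ * d
+*-mono-< {a} {b} {d} a′ {b′} a<d b<b′ = begin-strict
  a + b * d  <⟨ +-monoˡ-< (b * d) a<d ⟩
  d + b * d  ≤⟨ *-monoˡ-≤ d b<b′ ⟩
  b′ * d     ≤⟨ m≤n+m (b′ * d) a′ ⟩
  a′ + b′ * d ∎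
  where open ≤-Reasoning

double : ℕ → ℕ
double zero = zero
double (suc n) = suc (suc (double n))

double-mono-≤ : ∀ {m n} → m ≤ n → double m ≤ double n
double-mono-≤ z≤n = z≤n
double-mono-≤ (s≤s m≤n) = s≤s (s≤s (double-mono-≤ m≤n))

data EvenOdd : ℕ → Set where
  even : ∀ n → EvenOdd (double n)
  odd : ∀ n → EvenOdd (suc (double n))

evenOdd : ∀ n → EvenOdd n
evenOdd zero = even zero
evenOdd (suc n) with evenOdd n
... | even k = odd k
... | odd k = even (suc k)

alternate : ∀ {A : Set} → (ℕ → A) → (ℕ → A) → ℕ → A
alternate e o zero = e zero
alternate e o (suc zero) = o zero
alternate e o (suc (suc n)) = alternate (e ∘ suc) (o ∘ suc) n

alternate-even : ∀ {A : Set} (e o : ℕ → A) n → alternate e o (double n) ≡ e n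
alternate-even e o zero = refl
alternate-even e o (suc n) = alternate-even (e ∘ suc) (o ∘ suc) n

alternate-odd : ∀ {A : Set} (e o : ℕ → A) n → alternate e o (suc (double n)) ≡ o n
alternate-odd e o zero = refl
alternate-odd e o (suc n) = alternate-odd (e ∘ suc) (o ∘ suc) n

-- A layout places the holes on the orbits ("tracks") of the rotation. A track consists of the
-- columns 0 … N′, visited in turn, each a run of rows; column κ of track c reads entry c κ down to
-- row switch c κ and exit c κ below it. Hole j sits in row j of its column, which switches from
-- u_j to v_j; every other column is constant.
record Layout {m n} (u v : Vec (Fin m) n) : Set where
  field
    tracks N′ : ℕ
    entry exit : ℕ → ℕ → Fin m
    switch : ℕ → ℕ → ℕ
    track column : Fin n → ℕ
    track< : ∀ j → track j < tracks
    column≤ : ∀ j → column j ≤ N′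
    switch-hole : ∀ j → switch (track j) (column j) ≡ toℕ j
    entry-hole : ∀ j → entry (track j) (column j) ≡ lookup u j
    exit-hole : ∀ j → exit (track j) (column j) ≡ lookup v j
    plain-or-hole : ∀ c κ → entry c κ ≡ exit c κ ⊎ ∃[ j ] track j ≡ c × column j ≡ κ
    continuity : ∀ c κ → exit c κ ≡ entry c (suc κ)
    wrap : ∀ c → exit c N′ ≡ entry c 0

  hole-injective : ∀ {i j} → track i ≡ track j → column i ≡ column j → i ≡ j
  hole-injective {i} {j} same-track same-column = F.toℕ-injective (begin
    toℕ i                            ≡⟨ switch-hole i ⟨
    switch (track i) (column i)      ≡⟨ cong₂ switch same-track same-column ⟩
    switch (track j) (column j)      ≡⟨ switch-hole j ⟩
    toℕ j                            ∎)
    where open ≡-Reasoning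

  profile : ℕ → ℕ → ℕ → Fin m
  profile c ρ κ with ρ ≤? switch c κ
  ... | yes _ = entry c κ
  ... | no _ = exit c κ

  profile-entry : ∀ {c ρ κ} → ρ ≤ switch c κ → profile c ρ κ ≡ entry c κ
  profile-entry {c} {ρ} {κ} ρ≤s with ρ ≤? switch c κ
  ... | yes _ = refl
  ... | no ρ≰s = contradiction ρ≤s ρ≰s

  profile-exit : ∀ {c ρ κ} → switch c κ < ρ → profile c ρ κ ≡ exit c κ
  profile-exit {c} {ρ} {κ} s<ρ with ρ ≤? switch c κ
  ... | yes ρ≤s = contradiction ρ≤s (<⇒≱ s<ρ)
  ... | no _ = refl

  profile-plain : ∀ {c κ} ρ → entry c κ ≡ exit c κ → profile c ρ κ ≡ exit c κ
  profile-plain {c} {κ} ρ plain with ρ ≤? switch c κ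
  ... | yes _ = plain
  ... | no _ = refl

  profile-below-holes : ∀ c κ {ρ} → n ≤ ρ → profile c ρ κ ≡ exit c κ
  profile-below-holes c κ {ρ} n≤ρ with plain-or-hole c κ
  ... | inj₁ plain = profile-plain ρ plain
  ... | inj₂ (j , refl , refl) = profile-exit (subst (_< ρ) (sym (switch-hole j)) (≤-trans (F.toℕ<n j) n≤ρ))

  profile-step : ∀ c ρ κ →
    profile c (suc ρ) κ ≡ profile c ρ κ ⊎ ∃[ j ] track j ≡ c × column j ≡ κ × toℕ j ≡ ρ
  profile-step c ρ κ with <-cmp ρ (switch c κ)
  ... | tri< ρ<s _ _ = inj₁ (trans (profile-entry ρ<s) (sym (profile-entry (<⇒≤ ρ<s))))
  ... | tri> _ _ s<ρ = inj₁ (trans (profile-exit (m<n⇒m<1+n s<ρ)) (sym (profile-exit s<ρ)))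
  ... | tri≈ _ ρ≡s _ with plain-or-hole c κ
  ...   | inj₁ plain = inj₁ (trans (profile-exit (s≤s (≤-reflexive (sym ρ≡s))))
                                   (sym (trans (profile-entry (≤-reflexive ρ≡s)) plain)))
  ...   | inj₂ (j , on-track , in-column) =
          inj₂ (j , on-track , in-column , trans (sym (switch-hole j)) (trans (cong₂ switch on-track in-column) (sym ρ≡s)))

  exit≡entry-next : ∀ c {κ} → κ < suc N′ → exit c κ ≡ entry c (suc κ % suc N′)
  exit≡entry-next c {κ} κ<N with m≤n⇒m<n∨m≡n (≤-pred κ<N)
  ... | inj₁ κ<N′ = trans (continuity c κ) (cong (entry c) (sym (m<n⇒m%n≡m (s≤s κ<N′))))
  ... | inj₂ refl = trans (wrap c) (cong (entry c) (sym (n%n≡0 (suc N′))))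

empty-layout : ∀ {m} → Fin m → Layout {m} [] []
empty-layout d = record
  { tracks = 0 ; N′ = 0
  ; entry = λ _ _ → d ; exit = λ _ _ → d ; switch = λ _ _ → 0
  ; track = λ () ; column = λ ()
  ; track< = λ () ; column≤ = λ () ; switch-hole = λ () ; entry-hole = λ () ; exit-hole = λ ()
  ; plain-or-hole = λ _ _ → inj₁ refl ; continuity = λ _ _ → refl ; wrap = λ _ → refl }

module AddFixedLetter {m n} {u v : Vec (Fin m) n} (a : Fin m) (Λ : Layout u v) where
  open Layout Λ

  entry′ exit′ : ℕ → ℕ → Fin m
  entry′ zero _ = a
  entry′ (suc c) κ = entry c κ
  exit′ zero _ = a
  exit′ (suc c) κ = exit c κ

  switch′ : ℕ → ℕ → ℕ
  switch′ zero _ = 0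
  switch′ (suc c) κ = suc (switch c κ)

  track′ column′ : Fin (suc n) → ℕ
  track′ F.zero = 0
  track′ (F.suc j) = suc (track j)
  column′ F.zero = 0
  column′ (F.suc j) = column j

  track′< : ∀ j → track′ j < suc tracks
  track′< F.zero = s≤s z≤n
  track′< (F.suc j) = s≤s (track< j)

  column′≤ : ∀ j → column′ j ≤ N′
  column′≤ F.zero = z≤n
  column′≤ (F.suc j) = column≤ j

  switch′-hole : ∀ j → switch′ (track′ j) (column′ j) ≡ toℕ j
  switch′-hole F.zero = refl
  switch′-hole (F.suc j) = cong suc (switch-hole j)

  entry′-hole : ∀ j → entry′ (track′ j) (column′ j) ≡ lookup (a ∷ u) j
  entry′-hole F.zero = refl
  entry′-hole (F.suc j) = entry-hole j

  exit′-hole : ∀ j → exit′ (track′ j) (column′ j) ≡ lookup (a ∷ v) j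
  exit′-hole F.zero = refl
  exit′-hole (F.suc j) = exit-hole j

  plain-or-hole′ : ∀ c κ → entry′ c κ ≡ exit′ c κ ⊎ ∃[ j ] track′ j ≡ c × column′ j ≡ κ
  plain-or-hole′ zero κ = inj₁ refl
  plain-or-hole′ (suc c) κ with plain-or-hole c κ
  ... | inj₁ plain = inj₁ plain
  ... | inj₂ (j , on-track , in-column) = inj₂ (F.suc j , cong suc on-track , in-column)

  continuity′ : ∀ c κ → exit′ c κ ≡ entry′ c (suc κ)
  continuity′ zero κ = refl
  continuity′ (suc c) κ = continuity c κ

  wrap′ : ∀ c → exit′ c N′ ≡ entry′ c 0
  wrap′ zero = refl
  wrap′ (suc c) = wrap c

add-fixed-letter : ∀ {m n} {u v : Vec (Fin m) n} (a : Fin m) → Layout u v → Layout (a ∷ u) (a ∷ v)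
add-fixed-letter a Λ = record
  { tracks = suc (Layout.tracks Λ) ; N′ = Layout.N′ Λ
  ; entry = entry′ ; exit = exit′ ; switch = switch′ ; track = track′ ; column = column′
  ; track< = track′< ; column≤ = column′≤
  ; switch-hole = switch′-hole ; entry-hole = entry′-hole ; exit-hole = exit′-hole
  ; plain-or-hole = plain-or-hole′ ; continuity = continuity′ ; wrap = wrap′ }
  where open AddFixedLetter a Λ

-- Every column κ is split into the old column 2κ and a fresh column 2κ + 1 continuing its exit letter;
-- the fresh column after hole p receives the new hole 0, which switches from a to b, so that the
-- exit letter of hole p itself becomes a.
module SpliceLetter {m n} {u v : Vec (Fin m) n} {a b : Fin m} (p : Fin n) (vₚ≡a : lookup v p ≡ a)
                    (Λ : Layout u (v [ p ]≔ b)) where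
  open Layout Λ

  at-p? : ∀ c κ → Dec (c ≡ track p × κ ≡ column p)
  at-p? c κ = (c ≟ track p) ×-dec (κ ≟ column p)

  exit° : ℕ → ℕ → Fin m
  exit° c κ with at-p? c κ
  ... | yes _ = a
  ... | no _ = exit c κ

  exit°-at-p : exit° (track p) (column p) ≡ a
  exit°-at-p with at-p? (track p) (column p)
  ... | yes _ = refl
  ... | no not-at-p = contradiction (refl , refl) not-at-p

  exit°-elsewhere : ∀ {c κ} → ¬ (c ≡ track p × κ ≡ column p) → exit° c κ ≡ exit c κ
  exit°-elsewhere {c} {κ} not-at-p with at-p? c κ
  ... | yes at-p = contradiction at-p not-at-p
  ... | no _ = refl

  exit°-hole : ∀ j → exit° (track j) (column j) ≡ lookup v j
  exit°-hole j with j F.≟ p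
  ... | yes refl = trans exit°-at-p (sym vₚ≡a)
  ... | no j≢p = begin
    exit° (track j) (column j) ≡⟨ exit°-elsewhere (λ (same-track , same-column) → j≢p (hole-injective same-track same-column)) ⟩
    exit (track j) (column j)  ≡⟨ exit-hole j ⟩
    lookup (v [ p ]≔ b) j      ≡⟨ lookup∘update′ j≢p v b ⟩
    lookup v j                 ∎
    where open ≡-Reasoning

  entry′ exit′ : ℕ → ℕ → Fin m
  entry′ c = alternate (entry c) (exit° c)
  exit′ c = alternate (exit° c) (exit c)

  switch′ : ℕ → ℕ → ℕ
  switch′ c = alternate (suc ∘ switch c) (λ _ → 0)

  track′ column′ : Fin (suc n) → ℕ
  track′ F.zero = track p
  track′ (F.suc j) = track j
  column′ F.zero = suc (double (column p))
  column′ (F.suc j) = double (column j)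

  track′< : ∀ j → track′ j < tracks
  track′< F.zero = track< p
  track′< (F.suc j) = track< j

  column′≤ : ∀ j → column′ j ≤ suc (double N′)
  column′≤ F.zero = s≤s (double-mono-≤ (column≤ p))
  column′≤ (F.suc j) = m≤n⇒m≤1+n (double-mono-≤ (column≤ j))

  switch′-hole : ∀ j → switch′ (track′ j) (column′ j) ≡ toℕ j
  switch′-hole F.zero = alternate-odd _ _ (column p)
  switch′-hole (F.suc j) = trans (alternate-even _ _ (column j)) (cong suc (switch-hole j))

  entry′-hole : ∀ j → entry′ (track′ j) (column′ j) ≡ lookup (a ∷ u) j
  entry′-hole F.zero = trans (alternate-odd _ _ (column p)) exit°-at-p
  entry′-hole (F.suc j) = trans (alternate-even _ _ (column j)) (entry-hole j)

  exit′-hole : ∀ j → exit′ (track′ j) (column′ j) ≡ lookup (b ∷ v) j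
  exit′-hole F.zero = trans (alternate-odd _ _ (column p)) (trans (exit-hole p) (lookup∘update p v b))
  exit′-hole (F.suc j) = trans (alternate-even _ _ (column j)) (exit°-hole j)

  plain-or-hole′ : ∀ c κ → entry′ c κ ≡ exit′ c κ ⊎ ∃[ j ] track′ j ≡ c × column′ j ≡ κ
  plain-or-hole′ c κ′ with evenOdd κ′
  plain-or-hole′ c κ′ | even κ with at-p? c κ
  ... | yes (refl , refl) = inj₂ (F.suc p , refl , refl)
  ... | no not-at-p with plain-or-hole c κ
  ...   | inj₂ (j , on-track , in-column) = inj₂ (F.suc j , on-track , cong double in-column)
  ...   | inj₁ plain = inj₁ (begin
    entry′ c (double κ) ≡⟨ alternate-even _ _ κ ⟩
    entry c κ           ≡⟨ plain ⟩
    exit c κ            ≡⟨ exit°-elsewhere not-at-p ⟨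
    exit° c κ           ≡⟨ alternate-even _ _ κ ⟨
    exit′ c (double κ)  ∎)
    where open ≡-Reasoning
  plain-or-hole′ c κ′ | odd κ with at-p? c κ
  ... | yes (refl , refl) = inj₂ (F.zero , refl , refl)
  ... | no not-at-p = inj₁ (begin
    entry′ c (suc (double κ)) ≡⟨ alternate-odd _ _ κ ⟩
    exit° c κ                 ≡⟨ exit°-elsewhere not-at-p ⟩
    exit c κ                  ≡⟨ alternate-odd _ _ κ ⟨
    exit′ c (suc (double κ))  ∎)
    where open ≡-Reasoning

  continuity′ : ∀ c κ → exit′ c κ ≡ entry′ c (suc κ)
  continuity′ c κ′ with evenOdd κ′
  ... | even κ = trans (alternate-even _ _ κ) (sym (alternate-odd _ _ κ))
  ... | odd κ = trans (alternate-odd _ _ κ) (trans (continuity c κ) (sym (alternate-even (entry c) (exit° c) (suc κ))))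

  wrap′ : ∀ c → exit′ c (suc (double N′)) ≡ entry′ c 0
  wrap′ c = trans (alternate-odd _ _ N′) (wrap c)

splice-letter : ∀ {m n} {u v : Vec (Fin m) n} {a b : Fin m} (p : Fin n) → lookup v p ≡ a →
  Layout u (v [ p ]≔ b) → Layout (a ∷ u) (b ∷ v)
splice-letter p vₚ≡a Λ = record
  { tracks = Layout.tracks Λ ; N′ = suc (double (Layout.N′ Λ))
  ; entry = entry′ ; exit = exit′ ; switch = switch′ ; track = track′ ; column = column′
  ; track< = track′< ; column≤ = column′≤
  ; switch-hole = switch′-hole ; entry-hole = entry′-hole ; exit-hole = exit′-hole
  ; plain-or-hole = plain-or-hole′ ; continuity = continuity′ ; wrap = wrap′ }
  where open SpliceLetter p vₚ≡a Λ

layout : ∀ {m n} → Fin m → (u v : Vec (Fin m) n) → ParikhEqual (toList u) (toList v) → Layout u v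
layout d [] [] _ = empty-layout d
layout d (a ∷ u) (b ∷ v) same with a F.≟ b
... | yes refl = add-fixed-letter a (layout d u v (λ c → count-∷-cancel c a _ _ (same c)))
... | no a≢b with occurrence a v (count-∷-mismatch (toList u) (toList v) a≢b (same a))
...   | p , vₚ≡a = splice-letter p vₚ≡a (layout d u (v [ p ]≔ b) same′)
  where
  same′ : ParikhEqual (toList u) (toList (v [ p ]≔ b))
  same′ c = count-∷-cancel c a _ _ (trans (same c) (sym (count-update v p vₚ≡a c)))

-- Position k of the word lies on track k % tracks at height k / tracks (mod T), and height
-- κ + ρ * N is row ρ of column κ. The rotation by r = N * tracks moves one row down; as
-- T ≡ -1 (mod N), moving down from the last row reaches the top of the next column.
module Helix {m n} {u v : Vec (Fin m) (suc n)} (Λ : Layout u v) where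
  open Layout Λ

  N T L r : ℕ
  N = suc N′
  T = suc (suc n) * N + N′
  L = T * tracks
  r = N * tracks

  instance
    tracks-nonZero : NonZero tracks
    tracks-nonZero = >-nonZero (≤-<-trans z≤n (track< F.zero))

  point : ℕ → ℕ → Fin m
  point c q = profile c (q / N) (q % N)

  point-grid : ∀ c {κ} ρ → κ < N → point c (κ + ρ * N) ≡ profile c ρ κ
  point-grid c ρ κ<N = cong₂ (profile c) ([m+kn]/n≡k ρ κ<N) ([m+kn]%n≡m ρ κ<N)

  point-top : ∀ c {κ} → κ < N → point c κ ≡ entry c κ
  point-top c {κ} κ<N =
    trans (cong (point c) (sym (+-identityʳ κ))) (trans (point-grid c 0 κ<N) (profile-entry z≤n))

  grid<T : ∀ {κ ρ} → κ < N → ρ < suc (suc n) → κ + ρ * N < T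
  grid<T κ<N ρ<n+2 = ≤-trans (+*-mono-< 0 κ<N ρ<n+2) (m≤m+n _ N′)

  next-row : ∀ q → q + N ≡ q % N + suc (q / N) * N
  next-row q = begin
    q + N                        ≡⟨ cong (_+ N) (m≡m%n+[m/n]*n q N) ⟩
    q % N + q / N * N + N        ≡⟨ +-assoc (q % N) _ N ⟩
    q % N + (q / N * N + N)      ≡⟨ cong (q % N +_) (+-comm _ N) ⟩
    q % N + suc (q / N) * N      ∎
    where open ≡-Reasoning

  wrap-around : ∀ q → q < T → T ≤ q + N → (q + N) % T ≡ suc (q % N) % N
  wrap-around q q<T T≤q+N = begin
    (q + N) % T                         ≡⟨ m≤n⇒[n∸m]%m≡n%m T≤q+N ⟨
    x % T                               ≡⟨ m<n⇒m%n≡m (<-≤-trans x<N (≤-trans (m≤m+n N (suc n * N)) (m≤m+n _ N′))) ⟩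
    x                                   ≡⟨ m<n⇒m%n≡m x<N ⟨
    x % N                               ≡⟨ [m+kn]%n≡m%n x (suc (suc (suc n))) N ⟨
    (x + suc (suc (suc n)) * N) % N     ≡⟨ cong (_% N) x+[n+3]N≡ ⟩
    (suc (q % N) + suc (q / N) * N) % N ≡⟨ [m+kn]%n≡m%n (suc (q % N)) (suc (q / N)) N ⟩
    suc (q % N) % N                     ∎
    where
    open ≡-Reasoning
    x : ℕ
    x = q + N ∸ T
    x+T≡q+N : x + T ≡ q + N
    x+T≡q+N = m∸n+n≡m T≤q+N
    x<N : x < N
    x<N = +-cancelʳ-< T x N (subst (_< N + T) (sym x+T≡q+N) (subst (q + N <_) (+-comm T N) (+-monoˡ-< N q<T)))
    x+[n+3]N≡ : x + suc (suc (suc n)) * N ≡ suc (q % N) + suc (q / N) * N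
    x+[n+3]N≡ = begin
      x + (N + suc (suc n) * N)     ≡⟨ cong (x +_) (cong suc (+-comm N′ _)) ⟩
      x + suc T                     ≡⟨ +-suc x T ⟩
      suc (x + T)                   ≡⟨ cong suc x+T≡q+N ⟩
      suc (q + N)                   ≡⟨ cong suc (next-row q) ⟩
      suc (q % N) + suc (q / N) * N ∎

  point-step : ∀ c q → q < T →
    point c ((q + N) % T) ≡ point c q ⊎ ∃[ j ] track j ≡ c × q ≡ column j + toℕ j * N
  point-step c q q<T with q / N ≤? n
  ... | yes ρ≤n with profile-step c (q / N) (q % N)
  ...   | inj₁ unchanged = inj₁ (trans (cong (point c) (trans (m<n⇒m%n≡m q+N<T) (next-row q)))
                                (trans (point-grid c (suc (q / N)) (m%n<n q N)) unchanged))
    where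
    q+N<T : q + N < T
    q+N<T = subst (_< T) (sym (next-row q)) (grid<T (m%n<n q N) (s≤s (s≤s ρ≤n)))
  ...   | inj₂ (j , on-track , in-column , row) =
          inj₂ (j , on-track , trans (m≡m%n+[m/n]*n q N) (cong₂ (λ κ ρ → κ + ρ * N) (sym in-column) (sym row)))
  point-step c q q<T | no ρ≰n = inj₁ (trans next-point (sym (profile-below-holes c (q % N) (≰⇒> ρ≰n))))
    where
    next-point : point c ((q + N) % T) ≡ exit c (q % N)
    next-point with q + N <? T
    ... | yes q+N<T = begin
      point c ((q + N) % T)               ≡⟨ cong (point c) (trans (m<n⇒m%n≡m q+N<T) (next-row q)) ⟩
      point c (q % N + suc (q / N) * N)   ≡⟨ point-grid c (suc (q / N)) (m%n<n q N) ⟩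
      profile c (suc (q / N)) (q % N)     ≡⟨ profile-below-holes c (q % N) (m<n⇒m<1+n (≰⇒> ρ≰n)) ⟩
      exit c (q % N)                      ∎
      where open ≡-Reasoning
    ... | no q+N≮T = begin
      point c ((q + N) % T)               ≡⟨ cong (point c) (wrap-around q q<T (≮⇒≥ q+N≮T)) ⟩
      point c (suc (q % N) % N)           ≡⟨ point-top c (m%n<n (suc (q % N)) N) ⟩
      entry c (suc (q % N) % N)           ≡⟨ exit≡entry-next c (m%n<n q N) ⟨
      exit c (q % N)                      ∎
      where open ≡-Reasoning

  word : ℕ → Fin m
  word k = point (k % tracks) (k / tracks % T)

  word-periodic : ∀ k → word (k + L) ≡ word k
  word-periodic k = cong₂ point ([m+kn]%n≡m%n k T tracks)
    (trans (cong (_% T) ([m+kn]/n≡m/n+k k T tracks)) ([m+n]%n≡m%n (k / tracks) T))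

  word-grid : ∀ {c} q → c < tracks → q < T → word (c + q * tracks) ≡ point c q
  word-grid q c<g q<T = cong₂ point ([m+kn]%n≡m q c<g) (trans (cong (_% T) ([m+kn]/n≡k q c<g)) (m<n⇒m%n≡m q<T))

  hole : Fin (suc n) → ℕ
  hole j = track j + (column j + toℕ j * N) * tracks

  hole-increasing : ∀ {i j} → i F.< j → hole i < hole j
  hole-increasing {i} {j} i<j = +*-mono-< (track j) (track< i) (+*-mono-< (column j) (s≤s (column≤ i)) i<j)

  hole<L : ∀ j → hole j < L
  hole<L j = +*-mono-< 0 (track< j) (grid<T (s≤s (column≤ j)) (m<n⇒m<1+n (F.toℕ<n j)))

  word-hole : ∀ j → word (hole j) ≡ lookup u j
  word-hole j = begin
    word (hole j)                                ≡⟨ word-grid _ (track< j) (grid<T (s≤s (column≤ j)) (m<n⇒m<1+n (F.toℕ<n j))) ⟩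
    point (track j) (column j + toℕ j * N)       ≡⟨ point-grid (track j) (toℕ j) (s≤s (column≤ j)) ⟩
    profile (track j) (toℕ j) (column j)         ≡⟨ profile-entry (≤-reflexive (sym (switch-hole j))) ⟩
    entry (track j) (column j)                   ≡⟨ entry-hole j ⟩
    lookup u j                                   ∎
    where open ≡-Reasoning

  word-hole-rotated : ∀ j → word (hole j + r) ≡ lookup v j
  word-hole-rotated j = begin
    word (hole j + r)                                      ≡⟨ cong word hole+r ⟩
    word (track j + (column j + suc (toℕ j) * N) * tracks) ≡⟨ word-grid _ (track< j) (grid<T (s≤s (column≤ j)) (s≤s (F.toℕ<n j))) ⟩
    point (track j) (column j + suc (toℕ j) * N)           ≡⟨ point-grid (track j) (suc (toℕ j)) (s≤s (column≤ j)) ⟩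
    profile (track j) (suc (toℕ j)) (column j)             ≡⟨ profile-exit (s≤s (≤-reflexive (switch-hole j))) ⟩
    exit (track j) (column j)                              ≡⟨ exit-hole j ⟩
    lookup v j                                             ∎
    where
    open ≡-Reasoning
    q : ℕ
    q = column j + toℕ j * N
    hole+r : hole j + r ≡ track j + (column j + suc (toℕ j) * N) * tracks
    hole+r = begin
      track j + q * tracks + N * tracks               ≡⟨ +-assoc (track j) _ _ ⟩
      track j + (q * tracks + N * tracks)             ≡⟨ cong (track j +_) (*-distribʳ-+ tracks q N) ⟨
      track j + (q + N) * tracks                      ≡⟨ cong (λ t → track j + t * tracks) (+-assoc (column j) _ N) ⟩
      track j + (column j + (toℕ j * N + N)) * tracks ≡⟨ cong (λ t → track j + (column j + t) * tracks) (+-comm _ N) ⟩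
      track j + (column j + suc (toℕ j) * N) * tracks ∎

  word-off-holes : ∀ k → k < L → word k ≡ word (k + r) ⊎ ∃[ j ] hole j ≡ k
  word-off-holes k k<L with point-step (k % tracks) (k / tracks) (m<n*o⇒m/o<n k<L)
  ... | inj₁ unchanged = inj₁ (sym (begin
    word (k + r)                                   ≡⟨ cong₂ point ([m+kn]%n≡m%n k N tracks) (cong (_% T) ([m+kn]/n≡m/n+k k N tracks)) ⟩
    point (k % tracks) ((k / tracks + N) % T)      ≡⟨ unchanged ⟩
    point (k % tracks) (k / tracks)                ≡⟨ cong (point (k % tracks)) (m<n⇒m%n≡m (m<n*o⇒m/o<n k<L)) ⟨
    word k                                         ∎))
    where open ≡-Reasoning
  ... | inj₂ (j , on-track , at-hole) = inj₂ (j , trans (cong₂ (λ c q → c + q * tracks) on-track (sym at-hole))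
                                                      (sym (m≡m%n+[m/n]*n k tracks)))

  instance
    L-nonZero : NonZero L
    L-nonZero = m*n≢0 T tracks

  word-rotated : shift r (slice word 0 L) ≡ slice (λ k → word (k + r)) 0 L
  word-rotated = trans (shift-slice word (>-nonZero⁻¹ L) word-periodic r 0) (sym (slice-+ word r 0 L))

  equalizable : CycEqualizable (pair u v)
  equalizable with insertion-from-slices word (λ k → word (k + r)) u v hole 0 L hole-increasing
                     (λ j → z≤n , hole<L j) word-hole word-hole-rotated (λ k _ → word-off-holes k)
  ... | xs , u′≡ , v′≡ =
    equalizable-pair xs u v (subst₂ CycEq (sym u′≡) (trans word-rotated (sym v′≡)) (CycEq-shift r (slice word 0 L)))

ParikhEqual⇒equalizable : ∀ {m n} (u v : Vec (Fin m) n) → ParikhEqual (toList u) (toList v) → CycEqualizable (pair u v)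
ParikhEqual⇒equalizable [] [] _ = equalizable-pair ([] ∷ []) [] [] (CycEq-refl [])
ParikhEqual⇒equalizable u@(a ∷ _) v same = Helix.equalizable (layout a u v same)

theorem3 : (m n : ℕ) (u v : Vec (Fin m) n) →
    (CycEqualizable (pair u v) → (∀ a → Ψ (toList u) a ≡ Ψ (toList v) a))
    × ((∀ a → Ψ (toList u) a ≡ Ψ (toList v) a) → CycEqualizable (pair u v))
theorem3 m n u v = equalizable⇒ParikhEqual u v , ParikhEqual⇒equalizable u v
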